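{- Let $n\ge 4$ be an integer such that $n-1$ is prime. Then the prism graph $C_n\times P_2$ has a prime vertex labeling.
   Context: All graphs are simple and connected. A graph with $N$ vertices has a prime vertex labeling if its vertices can be labeled bijectively with $1,2,\ldots,N$ so that adjacent vertices receive relatively prime labels. $C_n$ is the $n$-vertex cycle, $P_2$ the path with $2$ vertices, and $\times$ denotes the Cartesian product of graphs; thus $C_n\times P_2$ consists of an inner $n$-cycle $c_{1,1},\ldots,c_{1,n}$ and an outer $n$-cycle $c_{2,1},\ldots,c_{2,n}$ with additional edges $c_{1,i}c_{2,i}$ for each $i$ ($2n$ vertices). -}

module Defs where

open import Data.Nat using (ℕ; suc; _+_; _*_; _%_; NonZero)
open import Data.Nat.Coprimality using (Coprime)
open import Data.Fin using (Fin; toℕ)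
open import Data.Product using (_×_; _,_; Σ)
open import Data.Sum using (_⊎_)
open import Relation.Binary.PropositionalEquality using (_≡_)
open import Function.Bundles using (_⤖_; Bijection)

record Graph (V : Set) : Set₁ where
  field
    Adj : V → V → Set

open Graph public

CycleAdj : (n : ℕ) → .{{_ : NonZero n}} → Fin n → Fin n → Set
CycleAdj n i j = (toℕ j ≡ (suc (toℕ i)) % n) ⊎ (toℕ i ≡ (suc (toℕ j)) % n)

Prism : (n : ℕ) → .{{_ : NonZero n}} → Graph (Fin 2 × Fin n)
Adj (Prism n) (a , i) (b , j) =
  ((a ≡ b) × CycleAdj n i j) ⊎ ((i ≡ j) × ((a ≡ b) → Data.Empty.⊥))
  where import Data.Empty

-- A prime vertex labeling of a graph on N vertices: a bijection from the
-- vertices onto {1,…,N} (encoded as Fin N, label = toℕ + 1) such that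
-- adjacent vertices receive relatively prime labels.
label : {N : ℕ} → Fin N → ℕ
label k = suc (toℕ k)

HasPrimeLabeling : {V : Set} (N : ℕ) → Graph V → Set
HasPrimeLabeling {V} N G =
  Σ (V ⤖ Fin N) λ f →
    ∀ u v → Adj G u v →
      Coprime (label (Bijection.to f u)) (label (Bijection.to f v))

-- n ≥ 4 gives the NonZero instance needed to form (_ % n).
open import Data.Nat using (_≤_; s≤s; z≤n)
4≤⇒nonZero : {n : ℕ} → 4 ≤ n → NonZero n
4≤⇒nonZero (s≤s _) = _

-- Write n = p + 1 and go around the cycles by index t = 0, …, n - 1.  The
-- labeling (from the paper) is
--   inner cycle:  1, n, p, 2, 3, …, p - 1        (index 3 + s gets 2 + s)
--   outer cycle:  2n - 2, 2n - 1, 2n, n + 1, …, 2n - 3  (index 3 + s gets n + 1 + s).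
-- Along each cycle neighbours are consecutive integers except for the pairs
-- (p, 2) and (2n, n + 1); rungs join x to x + p, except (1, 2n - 2) and
-- (p, 2n).  All of these are coprime because p is an odd prime.
module Submission where

open import Defs
open import Data.Nat using (ℕ; _≤_; _∸_; _*_)
open import Data.Nat.Primality using (Prime)

open import Data.Nat using (suc; _+_; _<_; _%_; NonZero; z≤n; s≤s; _≟_)
open import Data.Nat.Properties
  using (+-assoc; +-comm; +-suc; suc-injective; *-zeroʳ; *-identityʳ; m+[n∸m]≡n; m∸n+n≡m;
         m≤n+m; n<1+n; m+n≤o⇒n≤o; +-cancelˡ-≤; ≤-pred; 1+n≰n; 1+n≢n; m<1+n⇒m<n∨m≡n)
open import Data.Nat.DivMod
  using (%-distribˡ-+; m%n%n≡m%n; [m+n]%n≡m%n; m<n⇒m%n≡m; n%n≡0; m%n<n)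
open import Data.Nat.Coprimality as Coprimality
  using (Coprime; 1-coprimeTo; coprime-+; prime⇒coprime)
open import Data.Nat.Tactic.RingSolver using (solve-∀)
open import Data.Fin using (Fin; toℕ; fromℕ<)
open import Data.Fin.Patterns using (0F; 1F)
open import Data.Fin.Properties using (toℕ-fromℕ<; toℕ-injective; toℕ<n; toℕ-combine; *↔×)
open import Data.Fin.Permutation
  using (Permutation′; permutation; _⟨$⟩ʳ_; _⟨$⟩ˡ_; _∘ₚ_; inverseˡ; inverseʳ)
open import Data.Product using (_×_; _,_; Σ; proj₁; proj₂)
open import Data.Sum using (inj₁; inj₂)
open import Function using (_∘_)
open import Function.Bundles using (_↔_; Inverse; mk↔ₛ′)
open import Function.Construct.Composition using (_↔-∘_)
open import Function.Construct.Symmetry using (↔-sym)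
open import Function.Properties.Inverse using (↔⇒⤖)
open import Relation.Nullary using (yes; no; contradiction)
open import Relation.Binary.PropositionalEquality
  using (_≡_; _≢_; refl; sym; trans; cong; subst; subst₂; module ≡-Reasoning)

open ≡-Reasoning

Permutes : ℕ → (ℕ → ℕ) → Set
Permutes n f = Σ (Permutation′ n) λ π → ∀ i → toℕ (π ⟨$⟩ʳ i) ≡ f (toℕ i)

permutes-inverse : ∀ {n} (f g : ℕ → ℕ) →
  (∀ {x} → x < n → f x < n) → (∀ {x} → x < n → g x < n) →
  (∀ {x} → x < n → g (f x) ≡ x) → (∀ {x} → x < n → f (g x) ≡ x) →
  Permutes n f
permutes-inverse {n} f g f<n g<n g∘f f∘g =
  permutation to from to∘from from∘to , toℕ-to
  where
  to from : Fin n → Fin n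
  to i = fromℕ< (f<n (toℕ<n i))
  from j = fromℕ< (g<n (toℕ<n j))

  toℕ-to : ∀ i → toℕ (to i) ≡ f (toℕ i)
  toℕ-to i = toℕ-fromℕ< (f<n (toℕ<n i))

  toℕ-from : ∀ j → toℕ (from j) ≡ g (toℕ j)
  toℕ-from j = toℕ-fromℕ< (g<n (toℕ<n j))

  to∘from : ∀ j → to (from j) ≡ j
  to∘from j = toℕ-injective (begin
    toℕ (to (from j))  ≡⟨ toℕ-to (from j) ⟩
    f (toℕ (from j))   ≡⟨ cong f (toℕ-from j) ⟩
    f (g (toℕ j))      ≡⟨ f∘g (toℕ<n j) ⟩
    toℕ j              ∎)

  from∘to : ∀ i → from (to i) ≡ i
  from∘to i = toℕ-injective (begin
    toℕ (from (to i))  ≡⟨ toℕ-from (to i) ⟩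
    g (toℕ (to i))     ≡⟨ cong g (toℕ-to i) ⟩
    g (f (toℕ i))      ≡⟨ g∘f (toℕ<n i) ⟩
    toℕ i              ∎)

permutes-∘ : ∀ {n f g} → Permutes n f → Permutes n g → Permutes n (f ∘ g)
permutes-∘ {f = f} (π , π≗f) (σ , σ≗g) =
  σ ∘ₚ π , λ i → trans (π≗f (σ ⟨$⟩ʳ i)) (cong f (σ≗g i))

permutes-cong : ∀ {n f g} → Permutes n f → (∀ {x} → x < n → f x ≡ g x) → Permutes n g
permutes-cong (π , π≗f) f≗g = π , λ i → trans (π≗f i) (f≗g (toℕ<n i))

rotate : (n : ℕ) → .{{NonZero n}} → ℕ → ℕ → ℕ
rotate n c x = (x + c) % n

[m%d+k]%d≡[m+k]%d : ∀ m k d .{{_ : NonZero d}} → (m % d + k) % d ≡ (m + k) % d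
[m%d+k]%d≡[m+k]%d m k d = begin
  (m % d + k) % d            ≡⟨ %-distribˡ-+ (m % d) k d ⟩
  (m % d % d + k % d) % d    ≡⟨ cong (λ t → (t + k % d) % d) (m%n%n≡m%n m d) ⟩
  (m % d + k % d) % d        ≡⟨ %-distribˡ-+ m k d ⟨
  (m + k) % d                ∎

rotate-rotate : ∀ n .{{_ : NonZero n}} {a b x} → a + b ≡ n → x < n →
  rotate n b (rotate n a x) ≡ x
rotate-rotate n {a} {b} {x} a+b≡n x<n = begin
  ((x + a) % n + b) % n  ≡⟨ [m%d+k]%d≡[m+k]%d (x + a) b n ⟩
  (x + a + b) % n        ≡⟨ cong (_% n) (trans (+-assoc x a b) (cong (x +_) a+b≡n)) ⟩
  (x + n) % n            ≡⟨ [m+n]%n≡m%n x n ⟩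
  x % n                  ≡⟨ m<n⇒m%n≡m x<n ⟩
  x                      ∎

permutes-rotate : ∀ n .{{_ : NonZero n}} {c} → c ≤ n → Permutes n (rotate n c)
permutes-rotate n {c} c≤n =
  permutes-inverse (rotate n c) (rotate n (n ∸ c))
    (λ {x} _ → m%n<n (x + c) n) (λ {x} _ → m%n<n (x + (n ∸ c)) n)
    (rotate-rotate n (m+[n∸m]≡n c≤n)) (rotate-rotate n (m∸n+n≡m c≤n))

transposition : ℕ → ℕ → ℕ → ℕ
transposition a b x with x ≟ a
... | yes _ = b
... | no _ with x ≟ b
...   | yes _ = a
...   | no _ = x

transposition-left : ∀ a b → transposition a b a ≡ b
transposition-left a b with a ≟ a
... | yes _ = refl
... | no a≢a = contradiction refl a≢a

transposition-right : ∀ a b → transposition a b b ≡ a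
transposition-right a b with b ≟ a
... | yes b≡a = b≡a
... | no _ with b ≟ b
...   | yes _ = refl
...   | no b≢b = contradiction refl b≢b

transposition-other : ∀ {a b x} → x ≢ a → x ≢ b → transposition a b x ≡ x
transposition-other {a} {b} {x} x≢a x≢b with x ≟ a
... | yes x≡a = contradiction x≡a x≢a
... | no _ with x ≟ b
...   | yes x≡b = contradiction x≡b x≢b
...   | no _ = refl

transposition-involutive : ∀ a b x → transposition a b (transposition a b x) ≡ x
transposition-involutive a b x with x ≟ a
... | yes refl = transposition-right a b
... | no x≢a with x ≟ b
...   | yes refl = transposition-left a b
...   | no x≢b = transposition-other x≢a x≢b

transposition-< : ∀ {n a b x} → a < n → b < n → x < n → transposition a b x < n
transposition-< {a = a} {b} {x} a<n b<n x<n with x ≟ a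
... | yes _ = b<n
... | no _ with x ≟ b
...   | yes _ = a<n
...   | no _ = x<n

permutes-transposition : ∀ {n a b} → a < n → b < n → Permutes n (transposition a b)
permutes-transposition a<n b<n =
  permutes-inverse _ _ (transposition-< a<n b<n) (transposition-< a<n b<n)
    (λ {x} _ → transposition-involutive _ _ x) (λ {x} _ → transposition-involutive _ _ x)

-- One permutation per layer gives a bijection Fin m × Fin n ↔ Fin (m * n)
-- sending (a , i) to a * n + π a i: layer a fills the block [a n, a n + n).
layerwise : ∀ {m n} → (Fin m → Permutation′ n) → (Fin m × Fin n) ↔ Fin (m * n)
layerwise {m} {n} π = ↔-sym (*↔× {m} {n}) ↔-∘ permuteLayers
  where
  permuteLayers : (Fin m × Fin n) ↔ (Fin m × Fin n)
  permuteLayers = mk↔ₛ′ (λ (a , i) → a , π a ⟨$⟩ʳ i) (λ (a , j) → a , π a ⟨$⟩ˡ j)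
    (λ (a , j) → cong (a ,_) (inverseʳ (π a))) (λ (a , i) → cong (a ,_) (inverseˡ (π a)))

toℕ-layerwise : ∀ {m n} (π : Fin m → Permutation′ n) a i →
  toℕ (Inverse.to (layerwise π) (a , i)) ≡ n * toℕ a + toℕ (π a ⟨$⟩ʳ i)
toℕ-layerwise π a i = toℕ-combine a (π a ⟨$⟩ʳ i)

cycle-coprime : ∀ {p} (f : ℕ → ℕ) →
  (∀ {r} → r < p → Coprime (f r) (f (suc r))) → Coprime (f p) (f 0) →
  ∀ {r} → r < suc p → Coprime (f r) (f (suc r % suc p))
cycle-coprime {p} f path close {r} r<n with m<1+n⇒m<n∨m≡n r<n
... | inj₁ r<p  = subst (λ t → Coprime (f r) (f t)) (sym (m<n⇒m%n≡m (s≤s r<p))) (path r<p)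
... | inj₂ refl = subst (λ t → Coprime (f p) (f t)) (sym (n%n≡0 (suc p))) close

module _ (n : ℕ) .{{_ : NonZero n}} (lab : Fin 2 → ℕ → ℕ)
         (cycles : ∀ a {r} → r < n → Coprime (lab a r) (lab a (suc r % n)))
         (rungs : ∀ {r} → r < n → Coprime (lab 0F r) (lab 1F r)) where

  prism-coprime : ∀ {a i b j} → Adj (Prism n) (a , i) (b , j) →
    Coprime (lab a (toℕ i)) (lab b (toℕ j))
  prism-coprime {a} {i} (inj₁ (refl , inj₁ j≡i+1)) =
    subst (λ t → Coprime (lab a (toℕ i)) (lab a t)) (sym j≡i+1) (cycles a (toℕ<n i))
  prism-coprime {a} {_} {_} {j} (inj₁ (refl , inj₂ i≡j+1)) =
    subst (λ t → Coprime (lab a t) (lab a (toℕ j))) (sym i≡j+1)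
      (Coprimality.sym (cycles a (toℕ<n j)))
  prism-coprime {0F} {i} {0F} (inj₂ (_ , a≢b)) = contradiction refl a≢b
  prism-coprime {0F} {i} {1F} (inj₂ (refl , _)) = rungs (toℕ<n i)
  prism-coprime {1F} {i} {0F} (inj₂ (refl , _)) = Coprimality.sym (rungs (toℕ<n i))
  prism-coprime {1F} {i} {1F} (inj₂ (_ , a≢b)) = contradiction refl a≢b

  prism-prime-labeling : (value : Fin 2 → ℕ → ℕ) → (∀ a → Permutes n (value a)) →
    (∀ a r → suc (n * toℕ a + value a r) ≡ lab a r) →
    HasPrimeLabeling (2 * n) (Prism n)
  prism-prime-labeling value permutes labels = ↔⇒⤖ (layerwise π) , edges
    where
    π : Fin 2 → Permutation′ n
    π a = proj₁ (permutes a)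

    labelled : ∀ a i → label (Inverse.to (layerwise π) (a , i)) ≡ lab a (toℕ i)
    labelled a i = begin
      suc (toℕ (Inverse.to (layerwise π) (a , i)))  ≡⟨ cong suc (toℕ-layerwise π a i) ⟩
      suc (n * toℕ a + toℕ (π a ⟨$⟩ʳ i))           ≡⟨ cong (λ t → suc (n * toℕ a + t)) (proj₂ (permutes a) i) ⟩
      suc (n * toℕ a + value a (toℕ i))            ≡⟨ labels a (toℕ i) ⟩
      lab a (toℕ i)                                ∎

    edges : ∀ u v → Adj (Prism n) u v →
      Coprime (label (Inverse.to (layerwise π) u)) (label (Inverse.to (layerwise π) v))
    edges (a , i) (b , j) u~v =
      subst₂ Coprime (sym (labelled a i)) (sym (labelled b j)) (prism-coprime u~v)

consecutive : ∀ x → Coprime x (suc x)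
consecutive x = subst (Coprime x) (+-comm x 1) (Coprimality.sym (coprime-+ (1-coprimeTo x)))

-- The same, for m + x + 1 and m + x + 2 written as they arise in the outer layer.
consecutive-shift : ∀ m x → Coprime (suc (m + x)) (suc (m + suc x))
consecutive-shift m x = subst (Coprime (suc (m + x))) (cong suc (sym (+-suc m x))) (consecutive _)

coprime-add : ∀ {a b} → Coprime a b → Coprime a (a + b)
coprime-add a⊥b = Coprimality.sym (coprime-+ (Coprimality.sym a⊥b))

module PrimePrism (k : ℕ) (p-prime : Prime (3 + k)) where

  innerValue outerValue : ℕ → ℕ
  innerValue 0 = 0
  innerValue 1 = 3 + k
  innerValue 2 = 2 + k
  innerValue (suc (suc (suc s))) = 1 + s
  outerValue 0 = 1 + k
  outerValue 1 = 2 + k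
  outerValue 2 = 3 + k
  outerValue (suc (suc (suc s))) = s

  value : Fin 2 → ℕ → ℕ
  value 0F = innerValue
  value 1F = outerValue

  primeLabel : Fin 2 → ℕ → ℕ
  primeLabel 0F r = suc (innerValue r)
  primeLabel 1F r = suc (4 + k + outerValue r)

  value-label : ∀ a r → suc ((4 + k) * toℕ a + value a r) ≡ primeLabel a r
  value-label 0F r = cong (λ t → suc (t + innerValue r)) (*-zeroʳ (4 + k))
  value-label 1F r = cong (λ t → suc (t + outerValue r)) (*-identityʳ (4 + k))

  outer-rotation : ∀ {r} → r < 4 + k → rotate (4 + k) (1 + k) r ≡ outerValue r
  outer-rotation {0} _ = m<n⇒m%n≡m (m≤n+m (2 + k) 2)
  outer-rotation {1} _ = m<n⇒m%n≡m (m≤n+m (3 + k) 1)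
  outer-rotation {2} _ = m<n⇒m%n≡m (n<1+n (3 + k))
  outer-rotation {suc (suc (suc s))} r<n = begin
    (3 + s + (1 + k)) % (4 + k)  ≡⟨ cong (_% (4 + k)) (shift s k) ⟩
    (s + (4 + k)) % (4 + k)      ≡⟨ [m+n]%n≡m%n s (4 + k) ⟩
    s % (4 + k)                  ≡⟨ m<n⇒m%n≡m (m+n≤o⇒n≤o 3 r<n) ⟩
    s                            ∎
    where
    shift : ∀ s k → 3 + s + (1 + k) ≡ s + (4 + k)
    shift = solve-∀

  inner-rotation : ∀ {r} → r < 4 + k →
    transposition 0 (2 + k) (rotate (4 + k) (2 + k) r) ≡ innerValue r
  inner-rotation {0} _ = begin
    transposition 0 (2 + k) ((2 + k) % (4 + k))  ≡⟨ cong (transposition 0 (2 + k)) (m<n⇒m%n≡m (m≤n+m (3 + k) 1)) ⟩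
    transposition 0 (2 + k) (2 + k)              ≡⟨ transposition-right 0 (2 + k) ⟩
    0                                            ∎
  inner-rotation {1} _ = begin
    transposition 0 (2 + k) ((3 + k) % (4 + k))  ≡⟨ cong (transposition 0 (2 + k)) (m<n⇒m%n≡m (n<1+n (3 + k))) ⟩
    transposition 0 (2 + k) (3 + k)              ≡⟨ transposition-other {0} {2 + k} (λ ()) 1+n≢n ⟩
    3 + k                                        ∎
  inner-rotation {2} _ = begin
    transposition 0 (2 + k) ((4 + k) % (4 + k))  ≡⟨ cong (transposition 0 (2 + k)) (n%n≡0 (4 + k)) ⟩
    transposition 0 (2 + k) 0                    ≡⟨ transposition-left 0 (2 + k) ⟩
    2 + k                                        ∎
  inner-rotation {suc (suc (suc s))} r<n = begin
    transposition 0 (2 + k) ((3 + s + (2 + k)) % (4 + k))  ≡⟨ cong (transposition 0 (2 + k)) rotated ⟩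
    transposition 0 (2 + k) (1 + s)                        ≡⟨ transposition-other {0} {2 + k} (λ ()) 1+s≢2+k ⟩
    1 + s                                                  ∎
    where
    shift : ∀ s k → 3 + s + (2 + k) ≡ (1 + s) + (4 + k)
    shift = solve-∀

    rotated : (3 + s + (2 + k)) % (4 + k) ≡ 1 + s
    rotated = begin
      (3 + s + (2 + k)) % (4 + k)  ≡⟨ cong (_% (4 + k)) (shift s k) ⟩
      (1 + s + (4 + k)) % (4 + k)  ≡⟨ [m+n]%n≡m%n (1 + s) (4 + k) ⟩
      (1 + s) % (4 + k)            ≡⟨ m<n⇒m%n≡m (m+n≤o⇒n≤o 2 r<n) ⟩
      1 + s                        ∎

    1+s≢2+k : 1 + s ≢ 2 + k
    1+s≢2+k 1+s≡2+k = 1+n≰n (subst (_≤ k) (suc-injective 1+s≡2+k) (+-cancelˡ-≤ 4 _ _ r<n))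

  permutes-value : ∀ a → Permutes (4 + k) (value a)
  permutes-value 0F =
    permutes-cong
      (permutes-∘ {f = transposition 0 (2 + k)} {g = rotate (4 + k) (2 + k)}
                  (permutes-transposition (s≤s z≤n) (m≤n+m (3 + k) 1))
                  (permutes-rotate (4 + k) (m≤n+m (2 + k) 2)))
      inner-rotation
  permutes-value 1F = permutes-cong (permutes-rotate (4 + k) (m≤n+m (1 + k) 3)) outer-rotation

  p⊥2 : Coprime (3 + k) 2
  p⊥2 = prime⇒coprime p-prime (s≤s (s≤s (s≤s z≤n)))

  -- Inner cycle 1, n, p, 2, 3, …, p - 1: consecutive integers apart from
  -- (1, n), (p, 2) and the closing pair (p - 1, 1).
  inner-path : ∀ {r} → r < 3 + k → Coprime (primeLabel 0F r) (primeLabel 0F (suc r))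
  inner-path {0} _ = 1-coprimeTo _
  inner-path {1} _ = Coprimality.sym (consecutive (3 + k))
  inner-path {2} _ = p⊥2
  inner-path {suc (suc (suc s))} _ = consecutive (2 + s)

  inner-close : Coprime (primeLabel 0F (3 + k)) (primeLabel 0F 0)
  inner-close = Coprimality.sym (1-coprimeTo _)

  -- Outer cycle 2n - 2, 2n - 1, 2n, n + 1, …, 2n - 3: consecutive integers
  -- apart from (2n, n + 1) = ((p + 2) + p, p + 2).
  outer-path : ∀ {r} → r < 3 + k → Coprime (primeLabel 1F r) (primeLabel 1F (suc r))
  outer-path {0} _ = consecutive-shift (4 + k) (1 + k)
  outer-path {1} _ = consecutive-shift (4 + k) (2 + k)
  outer-path {2} _ =
    subst₂ Coprime (2n≡[p+2]+p k) (n+1≡p+2 k) (coprime-+ (coprime-add p⊥2))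
    where
    2n≡[p+2]+p : ∀ k → 3 + k + 2 + (3 + k) ≡ suc (4 + k + (3 + k))
    2n≡[p+2]+p = solve-∀
    n+1≡p+2 : ∀ k → 3 + k + 2 ≡ suc (4 + k + 0)
    n+1≡p+2 = solve-∀
  outer-path {suc (suc (suc s))} _ = consecutive-shift (4 + k) s

  outer-close : Coprime (primeLabel 1F (3 + k)) (primeLabel 1F 0)
  outer-close = consecutive-shift (4 + k) k

  cycles : ∀ a {r} → r < 4 + k → Coprime (primeLabel a r) (primeLabel a (suc r % (4 + k)))
  cycles 0F = cycle-coprime (primeLabel 0F) inner-path inner-close
  cycles 1F = cycle-coprime (primeLabel 1F) outer-path outer-close

  -- Rungs: (1, 2n - 2), (n, n + p), (p, p + (p + 2)) and (2 + s, (2 + s) + p).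
  rungs : ∀ {r} → r < 4 + k → Coprime (primeLabel 0F r) (primeLabel 1F r)
  rungs {0} _ = 1-coprimeTo _
  rungs {1} _ =
    subst (Coprime (4 + k)) (+-suc (4 + k) (2 + k))
      (coprime-add (Coprimality.sym (consecutive (3 + k))))
  rungs {2} _ = subst (Coprime (3 + k)) (2n≡p+[p+2] k) (coprime-add (coprime-add p⊥2))
    where
    2n≡p+[p+2] : ∀ k → 3 + k + (3 + k + 2) ≡ suc (4 + k + (3 + k))
    2n≡p+[p+2] = solve-∀
  rungs {suc (suc (suc s))} r<n =
    subst (Coprime (2 + s)) (n+1+s≡[2+s]+p s k)
      (coprime-add (Coprimality.sym (prime⇒coprime p-prime (≤-pred r<n))))
    where
    n+1+s≡[2+s]+p : ∀ s k → 2 + s + (3 + k) ≡ suc (4 + k + s)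
    n+1+s≡[2+s]+p = solve-∀

  prime-labeling : HasPrimeLabeling (2 * (4 + k)) (Prism (4 + k))
  prime-labeling =
    prism-prime-labeling (4 + k) primeLabel cycles rungs value permutes-value value-label

theorem7 : (n : ℕ) → (4≤n : 4 ≤ n) → Prime (n ∸ 1) →
    HasPrimeLabeling (2 * n) (Prism n {{4≤⇒nonZero 4≤n}})
theorem7 (suc (suc (suc (suc k)))) (s≤s (s≤s (s≤s (s≤s _)))) p-prime =
  PrimePrism.prime-labeling k p-prime
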